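{- For all $t,n\in\mathbb N$ we have $d(0,n)=0$ and \begin{align*} d(4t,4n)&=d(2t,2n), & d(4t+2,4n)&=d(2t+1,2n),\\ d(4t,4n+1)&=d(2t,2n), & d(4t+2,4n+1)&=d(2t+1,2n)+1,\\ d(4t,4n+2)&=d(2t,2n+1), & d(4t+2,4n+2)&=d(2t+1,2n+1),\\ d(4t,4n+3)&=d(2t,2n+1), & d(4t+2,4n+3)&=d(2t+1,2n+1)-1,\\ d(4t+1,4n)&=d(2t,2n), & d(4t+3,4n)&=d(2t+1,2n)+1,\\ d(4t+1,4n+1)&=d(2t+1,2n), & d(4t+3,4n+1)&=d(2t+2,2n),\\ d(4t+1,4n+2)&=d(2t,2n+1)+1, & d(4t+3,4n+2)&=d(2t+1,2n+1),\\ d(4t+1,4n+3)&=d(2t+1,2n+1)-1, & d(4t+3,4n+3)&=d(2t+2,2n+1)-1. \end{align*}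
   Context: Convention: $0\in\mathbb N$. For $n\in\mathbb N$ with binary expansion $n=\sum_{j\ge0}\delta_j(n)2^j$, $\delta_j(n)\in\{0,1\}$, let $\mathsf r(n)=\#\{j\ge0:\delta_{j+1}(n)=\delta_j(n)=1\}$ (number of overlapping occurrences of $\mathtt{11}$ in the binary expansion of $n$). For $t,n\in\mathbb N$ define $d(t,n)=\mathsf r(n+t)-\mathsf r(n)$. -}

module Defs where

open import Data.Nat using (ℕ; zero; suc; _+_; _*_)
open import Data.Nat.DivMod using (_/_; _%_)
open import Data.Integer using (ℤ; +_; _-_)

-- δ j n : the j-th binary digit of n
-- Indicator that the two lowest binary digits of n are both 1 (n mod 4 = 3).
low11 : ℕ → ℕ
low11 n with n % 4
... | 3 = 1
... | _ = 0

-- rAux k n counts occurrences of 11 among the first k bit positions j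
-- (pairs (δ_j, δ_{j+1}) for j < k). With fuel k = n all positions are covered,
-- since n has fewer than n+1 binary digits.
rAux : ℕ → ℕ → ℕ
rAux zero    _ = 0
rAux (suc k) n = low11 n + rAux k (n / 2)

r : ℕ → ℕ
r n = rAux n n

d : ℕ → ℕ → ℤ
d t n = + r (n + t) - + r n

-- Peeling off the lowest binary digit gives r n = [n ≡ 3 mod 4] + r ⌊n/2⌋. Write t = 4t′ + a and
-- n = 4n′ + b with digits a, b < 4, so that n + t = 4(n′ + t′) + (a + b). Peeling once from both
-- r (n + t) and r n, the remaining arguments are 2(n′ + t′) + ⌊(a+b)/2⌋ and 2n′ + ⌊b/2⌋, which differ
-- by 2t′ + a′ with a′ = ⌊(a+b)/2⌋ − ⌊b/2⌋. Hence d(4t′ + a, 4n′ + b) = d(2t′ + a′, 2n′ + ⌊b/2⌋)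
-- + [a + b ≡ 3 mod 4] − [b = 3], and the sixteen identities are the instances a, b < 4.
module Submission where

open import Defs
open import Data.Nat using (ℕ; zero; suc; _*_; _+_; _∸_; _≤_; z≤n; s≤s)
open import Data.Nat.Properties using (≤-trans; ≤-pred; ≤-refl; m≤n+m; m+[n∸m]≡n; +-identityʳ)
open import Data.Nat.DivMod using (_/_; _%_; m/n<m; /-monoˡ-≤; +-distrib-/-∣ˡ; m*n/n≡m; [m+kn]%n≡m%n)
open import Data.Nat.Divisibility using (divides-refl)
open import Data.Nat.Tactic.RingSolver using (solve-∀)
open import Data.Integer using (ℤ; +_; _⊖_)
open import Data.Integer as ℤ using ()
open import Data.Integer.Properties as ℤₚ using (pos-+; [+m]-[+n]≡m⊖n)
import Data.Integer.Tactic.RingSolver as ℤ-Solver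
open import Data.Product using (_×_; _,_)
open import Relation.Binary.PropositionalEquality using (_≡_; refl; sym; trans; cong; cong₂; module ≡-Reasoning)

n≤1+k⇒n/2≤k : ∀ {n k} → n ≤ suc k → n / 2 ≤ k
n≤1+k⇒n/2≤k {zero}  _   = z≤n
n≤1+k⇒n/2≤k {suc m} n≤k = ≤-trans (≤-pred (m/n<m (suc m) 2 (s≤s (s≤s z≤n)))) (≤-pred n≤k)

rAux-zero : ∀ k → rAux k 0 ≡ 0
rAux-zero zero    = refl
rAux-zero (suc k) = rAux-zero k

rAux-fuel : ∀ {j k n} → n ≤ j → n ≤ k → rAux j n ≡ rAux k n
rAux-fuel {zero}  {k}     z≤n _   = sym (rAux-zero k)
rAux-fuel {suc j} {zero}  _   z≤n = rAux-zero (suc j)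
rAux-fuel {suc j} {suc k} {n} n≤j n≤k =
  cong (_+_ (low11 n)) (rAux-fuel (n≤1+k⇒n/2≤k n≤j) (n≤1+k⇒n/2≤k n≤k))

r-half : ∀ n → r n ≡ low11 n + r (n / 2)
r-half zero    = refl
r-half (suc m) = cong (_+_ (low11 (suc m))) (rAux-fuel {m} (n≤1+k⇒n/2≤k ≤-refl) ≤-refl)

[4m+k]%4≡k%4 : ∀ m k → (4 * m + k) % 4 ≡ k % 4
[4m+k]%4≡k%4 m k = trans (cong (_% 4) (4m+k≡k+m*4 m k)) ([m+kn]%n≡m%n k m 4)
  where
  4m+k≡k+m*4 : ∀ m k → 4 * m + k ≡ k + m * 4
  4m+k≡k+m*4 = solve-∀

low11[4m+k]≡low11[k] : ∀ m k → low11 (4 * m + k) ≡ low11 k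
low11[4m+k]≡low11[k] m k with (4 * m + k) % 4 | [4m+k]%4≡k%4 m k
... | _ | refl = refl

[4m+k]/2≡2m+k/2 : ∀ m k → (4 * m + k) / 2 ≡ 2 * m + k / 2
[4m+k]/2≡2m+k/2 m k = begin
  (4 * m + k) / 2         ≡⟨ cong (λ x → (x + k) / 2) (4m≡2m*2 m) ⟩
  (2 * m * 2 + k) / 2     ≡⟨ +-distrib-/-∣ˡ k (divides-refl (2 * m)) ⟩
  2 * m * 2 / 2 + k / 2   ≡⟨ cong (_+ k / 2) (m*n/n≡m (2 * m) 2) ⟩
  2 * m + k / 2           ∎
  where
  open ≡-Reasoning
  4m≡2m*2 : ∀ m → 4 * m ≡ 2 * m * 2
  4m≡2m*2 = solve-∀

r-quarter : ∀ m k → r (4 * m + k) ≡ low11 k + r (2 * m + k / 2)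
r-quarter m k = begin
  r (4 * m + k)                           ≡⟨ r-half (4 * m + k) ⟩
  low11 (4 * m + k) + r ((4 * m + k) / 2) ≡⟨ cong₂ _+_ (low11[4m+k]≡low11[k] m k) (cong r ([4m+k]/2≡2m+k/2 m k)) ⟩
  low11 k + r (2 * m + k / 2)             ∎
  where open ≡-Reasoning

r-quarter-sum : ∀ t n a b →
  r (4 * n + b + (4 * t + a)) ≡ low11 (a + b) + r (2 * n + b / 2 + (2 * t + ((a + b) / 2 ∸ b / 2)))
r-quarter-sum t n a b = begin
  r (4 * n + b + (4 * t + a))                    ≡⟨ cong r (regroup n t a b) ⟩
  r (4 * (n + t) + (a + b))                      ≡⟨ r-quarter (n + t) (a + b) ⟩
  low11 (a + b) + r (2 * (n + t) + c)            ≡⟨ cong (λ x → low11 (a + b) + r (2 * (n + t) + x)) (sym (m+[n∸m]≡n e≤c)) ⟩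
  low11 (a + b) + r (2 * (n + t) + (e + (c ∸ e))) ≡⟨ cong (λ x → low11 (a + b) + r x) (split-halves e (c ∸ e) n t) ⟩
  low11 (a + b) + r (2 * n + e + (2 * t + (c ∸ e))) ∎
  where
  open ≡-Reasoning
  c e : ℕ
  c = (a + b) / 2
  e = b / 2
  e≤c : e ≤ c
  e≤c = /-monoˡ-≤ 2 (m≤n+m b a)
  regroup : ∀ n t a b → 4 * n + b + (4 * t + a) ≡ 4 * (n + t) + (a + b)
  regroup = solve-∀
  split-halves : ∀ e f n t → 2 * (n + t) + (e + f) ≡ 2 * n + e + (2 * t + f)
  split-halves = solve-∀

d-split : ∀ {T N T′ N′ c c′} → r (N + T) ≡ c + r (N′ + T′) → r N ≡ c′ + r N′ →
          d T N ≡ d T′ N′ ℤ.+ (c ⊖ c′)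
d-split {T} {N} {T′} {N′} {c} {c′} sum low = begin
  + r (N + T) ℤ.- + r N                       ≡⟨ cong₂ (λ x y → + x ℤ.- + y) sum low ⟩
  + (c + r (N′ + T′)) ℤ.- + (c′ + r N′)       ≡⟨ cong₂ (λ x y → x ℤ.- y) (pos-+ c _) (pos-+ c′ _) ⟩
  (+ c ℤ.+ + r (N′ + T′)) ℤ.- (+ c′ ℤ.+ + r N′) ≡⟨ rearrange (+ c) (+ c′) (+ r (N′ + T′)) (+ r N′) ⟩
  d T′ N′ ℤ.+ (+ c ℤ.- + c′)                  ≡⟨ cong (ℤ._+_ (d T′ N′)) ([+m]-[+n]≡m⊖n c c′) ⟩
  d T′ N′ ℤ.+ (c ⊖ c′)                        ∎
  where
  open ≡-Reasoning
  rearrange : ∀ (x x′ y y′ : ℤ) → (x ℤ.+ y) ℤ.- (x′ ℤ.+ y′) ≡ (y ℤ.- y′) ℤ.+ (x ℤ.- x′)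
  rearrange = ℤ-Solver.solve-∀

-- m ⊕ k and x ⊞ c are m + k and x ℤ.+ c, except that they reduce to m and x when k and c are
-- literally 0; since x ℤ.+ -[1+ 0] is x ℤ.- + 1 by definition, instantiating d-quarter at
-- numerals then yields exactly the shapes of lemma3p1.
infixl 6 _⊕_ _⊞_

_⊕_ : ℕ → ℕ → ℕ
m ⊕ zero  = m
m ⊕ suc k = m + suc k

⊕-≡ : ∀ m k → m ⊕ k ≡ m + k
⊕-≡ m zero    = sym (+-identityʳ m)
⊕-≡ m (suc k) = refl

_⊞_ : ℤ → ℤ → ℤ
x ⊞ (+ zero) = x
x ⊞ c        = x ℤ.+ c

⊞-≡ : ∀ x c → x ⊞ c ≡ x ℤ.+ c
⊞-≡ x (+ zero)    = sym (ℤₚ.+-identityʳ x)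
⊞-≡ x (+ suc _)   = refl
⊞-≡ x ℤ.-[1+ _ ]  = refl

d-quarter : ∀ t n a b →
  d (4 * t ⊕ a) (4 * n ⊕ b) ≡ d (2 * t ⊕ ((a + b) / 2 ∸ b / 2)) (2 * n ⊕ b / 2) ⊞ (low11 (a + b) ⊖ low11 b)
d-quarter t n a b = begin
  d (4 * t ⊕ a) (4 * n ⊕ b)          ≡⟨ cong₂ d (⊕-≡ (4 * t) a) (⊕-≡ (4 * n) b) ⟩
  d (4 * t + a) (4 * n + b)          ≡⟨ d-split {4 * t + a} {4 * n + b} {2 * t + a′} {2 * n + b′} {low11 (a + b)} {low11 b}
                                                (r-quarter-sum t n a b) (r-quarter n b) ⟩
  d (2 * t + a′) (2 * n + b′) ℤ.+ c  ≡⟨ cong₂ (λ T N → d T N ℤ.+ c) (sym (⊕-≡ (2 * t) a′)) (sym (⊕-≡ (2 * n) b′)) ⟩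
  d (2 * t ⊕ a′) (2 * n ⊕ b′) ℤ.+ c  ≡⟨ sym (⊞-≡ (d (2 * t ⊕ a′) (2 * n ⊕ b′)) c) ⟩
  d (2 * t ⊕ a′) (2 * n ⊕ b′) ⊞ c    ∎
  where
  open ≡-Reasoning
  a′ b′ : ℕ
  a′ = (a + b) / 2 ∸ b / 2
  b′ = b / 2
  c : ℤ
  c = low11 (a + b) ⊖ low11 b

d-zero : ∀ n → d 0 n ≡ + 0
d-zero n = trans (cong (λ m → + r m ℤ.- + r n) (+-identityʳ n)) (ℤₚ.+-inverseʳ (+ r n))

lemma3p1 : (t n : ℕ) →
    d 0 n ≡ + 0
    × d (4 * t) (4 * n) ≡ d (2 * t) (2 * n)
    × d (4 * t) (4 * n + 1) ≡ d (2 * t) (2 * n)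
    × d (4 * t) (4 * n + 2) ≡ d (2 * t) (2 * n + 1)
    × d (4 * t) (4 * n + 3) ≡ d (2 * t) (2 * n + 1)
    × d (4 * t + 1) (4 * n) ≡ d (2 * t) (2 * n)
    × d (4 * t + 1) (4 * n + 1) ≡ d (2 * t + 1) (2 * n)
    × d (4 * t + 1) (4 * n + 2) ≡ d (2 * t) (2 * n + 1) ℤ.+ + 1
    × d (4 * t + 1) (4 * n + 3) ≡ d (2 * t + 1) (2 * n + 1) ℤ.- + 1
    × d (4 * t + 2) (4 * n) ≡ d (2 * t + 1) (2 * n)
    × d (4 * t + 2) (4 * n + 1) ≡ d (2 * t + 1) (2 * n) ℤ.+ + 1
    × d (4 * t + 2) (4 * n + 2) ≡ d (2 * t + 1) (2 * n + 1)
    × d (4 * t + 2) (4 * n + 3) ≡ d (2 * t + 1) (2 * n + 1) ℤ.- + 1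
    × d (4 * t + 3) (4 * n) ≡ d (2 * t + 1) (2 * n) ℤ.+ + 1
    × d (4 * t + 3) (4 * n + 1) ≡ d (2 * t + 2) (2 * n)
    × d (4 * t + 3) (4 * n + 2) ≡ d (2 * t + 1) (2 * n + 1)
    × d (4 * t + 3) (4 * n + 3) ≡ d (2 * t + 2) (2 * n + 1) ℤ.- + 1
lemma3p1 t n = d-zero n
  , d-quarter t n 0 0 , d-quarter t n 0 1 , d-quarter t n 0 2 , d-quarter t n 0 3
  , d-quarter t n 1 0 , d-quarter t n 1 1 , d-quarter t n 1 2 , d-quarter t n 1 3
  , d-quarter t n 2 0 , d-quarter t n 2 1 , d-quarter t n 2 2 , d-quarter t n 2 3
  , d-quarter t n 3 0 , d-quarter t n 3 1 , d-quarter t n 3 2 , d-quarter t n 3 3
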